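{- If $S$ is a vf-safe delta-matroid and $e\in E(S)$, then $S\ddagger e$ is vf-safe.
   Context: A set system is a pair $S=(E,\mathcal F)$ where $E$ is a finite set and $\mathcal F$ is a collection of subsets of $E$ (the feasible sets); $S$ is proper if $\mathcal F\neq\emptyset$. A delta-matroid is a proper set system such that for all $X,Y\in\mathcal F$ and all $u\in X\triangle Y$ there is $v\in X\triangle Y$ (possibly $v=u$) with $X\triangle\{u,v\}\in\mathcal F$. For $e\in E$: $e$ is a loop if it lies in no feasible set, and a coloop if it lies in every feasible set. If $e$ is not a loop, $S/e=(E-e,\{F-e: e\in F\in\mathcal F\})$; if $e$ is a loop, $S/e$ is defined as $S\setminus e=(E-e,\{F\in\mathcal F: e\notin F\})$. For $A\subseteq E$, the twist is $S*A=(E,\{F\triangle A: F\in\mathcal F\})$, and the loop complementation $S+A$ is the set system on $E$ in which $F\subseteq E$ is feasible if and only if $S$ has an odd number of feasible sets $F'$ with $F-A\subseteq F'\subseteq F$ (write $S+e$ for $S+\{e\}$). A twisted dual of $S$ is any set system obtained from $S$ by a finite sequence of twists and loop complementations. A delta-matroid is vf-safe if all of its twisted duals are delta-matroids. The Penrose contraction is $S\ddagger e=(S+e)/e$. -}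

module Defs where

open import Data.Nat using (ℕ; zero; suc)
open import Data.Bool using (Bool; true; false; not; _∧_; _∨_; _xor_; if_then_else_)
open import Data.Fin using (Fin)
open import Data.Vec using (Vec; []; _∷_; zipWith; lookup; insertAt)
open import Data.List using (List; []; _∷_; map; _++_; foldr)
open import Data.Fin.Subset using (Subset; _∈_; _─_; ⁅_⁆; _∪_)
open import Data.Product using (Σ; ∃; _×_; _,_)
open import Relation.Binary.PropositionalEquality using (_≡_)

SetSystem : ℕ → Set
SetSystem n = Subset n → Bool

Feasible : ∀ {n} → SetSystem n → Subset n → Set
Feasible S X = S X ≡ true

_△_ : ∀ {n} → Subset n → Subset n → Subset n
X △ Y = zipWith _xor_ X Y

allSubsets : (n : ℕ) → List (Subset n)
allSubsets zero = [] ∷ []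
allSubsets (suc n) = map (false ∷_) (allSubsets n) ++ map (true ∷_) (allSubsets n)

_⊆ᵇ_ : ∀ {n} → Subset n → Subset n → Bool
[] ⊆ᵇ [] = true
(x ∷ X) ⊆ᵇ (y ∷ Y) = (not x ∨ y) ∧ (X ⊆ᵇ Y)

oddCount : ∀ {A : Set} → (A → Bool) → List A → Bool
oddCount p = foldr (λ a b → p a xor b) false

Proper : ∀ {n} → SetSystem n → Set
Proper S = ∃ λ X → Feasible S X

IsDeltaMatroid : ∀ {n} → SetSystem n → Set
IsDeltaMatroid {n} S =
  Proper S ×
  (∀ (X Y : Subset n) → Feasible S X → Feasible S Y →
     ∀ (u : Fin n) → u ∈ (X △ Y) →
       ∃ λ (v : Fin n) → v ∈ (X △ Y) × Feasible S (X △ (⁅ u ⁆ ∪ ⁅ v ⁆)))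
-- ({u,v} = ⁅ u ⁆ ∪ ⁅ v ⁆, which is {u} when v = u)

_*ₜ_ : ∀ {n} → SetSystem n → Subset n → SetSystem n
(S *ₜ A) F = S (F △ A)

_+ₗ_ : ∀ {n} → SetSystem n → Subset n → SetSystem n
_+ₗ_ {n} S A F = oddCount (λ F' → ((F ─ A) ⊆ᵇ F') ∧ (F' ⊆ᵇ F) ∧ S F') (allSubsets n)

data TwistedDual {n : ℕ} (S : SetSystem n) : SetSystem n → Set where
  tdRefl  : TwistedDual S S
  tdTwist : ∀ {T} → TwistedDual S T → (A : Subset n) → TwistedDual S (T *ₜ A)
  tdLoop  : ∀ {T} → TwistedDual S T → (A : Subset n) → TwistedDual S (T +ₗ A)

IsVfSafe : ∀ {n} → SetSystem n → Set
IsVfSafe S = IsDeltaMatroid S × (∀ T → TwistedDual S T → IsDeltaMatroid T)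

-- e is a loop: e lies in no feasible set (Boolean version: some feasible set contains e)
containsNonLoop : ∀ {n} → SetSystem n → Fin n → Bool
containsNonLoop {n} S e = foldr (λ F b → (S F ∧ lookup F e) ∨ b) false (allSubsets n)

-- contraction S / e on ground set Fin (suc n), yielding a set system on the
-- remaining elements, identified with Fin n via insertion at position e.
-- If e is a loop, S / e = S \ e.
_/ₑ_ : ∀ {n} → SetSystem (suc n) → Fin (suc n) → SetSystem n
(S /ₑ e) F = if containsNonLoop S e then S (insertAt F e true) else S (insertAt F e false)

_‡_ : ∀ {n} → SetSystem (suc n) → Fin (suc n) → SetSystem n
S ‡ e = (S +ₗ ⁅ e ⁆) /ₑ e

module Submission where

-- The Penrose contraction S ‡ e = (S + e) / e is, pointwise, a *slice* of the
-- twisted dual S + e: the set system on E - e obtained by fixing the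
-- membership of e to one Boolean value b (b = true unless e is a loop of
-- S + e).  The theorem follows from three facts about slices.
--   (1) Slicing commutes with twists and loop complementations by sets
--       avoiding e; hence every twisted dual of a slice of S is a slice (at
--       the same b) of a twisted dual of S.
--   (2) Slicing preserves the symmetric exchange axiom.
--   (3) Twists and loop complementations preserve properness, and the slice
--       chosen by a contraction of a proper set system is proper.
-- So a twisted dual of S ‡ e is proper by (3), and satisfies exchange by
-- (1) and (2) because twisted duals of S do.

open import Defs
open import Data.Nat using (ℕ; suc)
open import Data.Fin using (Fin; zero; suc; punchIn; punchOut)
open import Data.Fin.Properties using (punchIn-punchOut)
open import Data.Bool using (Bool; true; false; _∧_; _∨_; _xor_)
open import Data.Bool.Properties using (xor-assoc; xor-same; xor-identityʳ; ∧-zeroʳ)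
open import Data.Vec using (Vec; []; _∷_; zipWith; lookup; insertAt; removeAt)
open import Data.Vec.Properties
  using (insertAt-lookup; insertAt-punchIn; insertAt-removeAt; []=⇒lookup; lookup⇒[]=)
open import Data.List using (List; []; _∷_; map; _++_; foldr)
open import Data.List.Membership.Propositional using () renaming (_∈_ to _∈ₗ_)
open import Data.List.Membership.Propositional.Properties using (∈-map⁺; ∈-++⁺ˡ; ∈-++⁺ʳ)
open import Data.List.Relation.Unary.Any using (here; there)
open import Data.Fin.Subset using (Subset; _∈_; _─_; ⁅_⁆; _∪_; ⊥)
open import Data.Product using (∃; _×_; _,_; proj₁; proj₂)
open import Data.Sum using (_⊎_; inj₁; inj₂)
open import Relation.Binary.PropositionalEquality

∧-true⁻ : ∀ x {y} → x ∧ y ≡ true → x ≡ true × y ≡ true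
∧-true⁻ true h = refl , h
∧-true⁻ false ()

∨-false⁻ : ∀ x {y} → x ∨ y ≡ false → x ≡ false × y ≡ false
∨-false⁻ false h = refl , h
∨-false⁻ true ()

oddCount-++ : ∀ {A : Set} (p : A → Bool) (xs ys : List A) →
  oddCount p (xs ++ ys) ≡ oddCount p xs xor oddCount p ys
oddCount-++ p [] ys = refl
oddCount-++ p (x ∷ xs) ys =
  trans (cong (p x xor_) (oddCount-++ p xs ys)) (sym (xor-assoc (p x) _ _))

oddCount-map : ∀ {A B : Set} (p : B → Bool) (f : A → B) (xs : List A) →
  oddCount p (map f xs) ≡ oddCount (λ a → p (f a)) xs
oddCount-map p f [] = refl
oddCount-map p f (x ∷ xs) = cong (p (f x) xor_) (oddCount-map p f xs)

oddCount-cong : ∀ {A : Set} {p q : A → Bool} → (∀ x → p x ≡ q x) →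
  (xs : List A) → oddCount p xs ≡ oddCount q xs
oddCount-cong p≗q [] = refl
oddCount-cong p≗q (x ∷ xs) = cong₂ _xor_ (p≗q x) (oddCount-cong p≗q xs)

oddCount-none : ∀ {A : Set} {p : A → Bool} → (∀ x → p x ≡ false) →
  (xs : List A) → oddCount p xs ≡ false
oddCount-none p≗false [] = refl
oddCount-none p≗false (x ∷ xs) rewrite p≗false x = oddCount-none p≗false xs

oddCount-allSubsets : ∀ {n} (p : Subset (suc n) → Bool) →
  oddCount p (allSubsets (suc n)) ≡
  oddCount (λ G → p (false ∷ G)) (allSubsets n) xor oddCount (λ G → p (true ∷ G)) (allSubsets n)
oddCount-allSubsets {n} p =
  trans (oddCount-++ p (map (false ∷_) (allSubsets n)) (map (true ∷_) (allSubsets n)))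
        (cong₂ _xor_ (oddCount-map p _ (allSubsets n)) (oddCount-map p _ (allSubsets n)))

-- Boolean "some member satisfies g", in the shape used by containsNonLoop.
anyᵇ : ∀ {A : Set} → (A → Bool) → List A → Bool
anyᵇ g = foldr (λ x b → g x ∨ b) false

anyᵇ-witness : ∀ {A : Set} (g : A → Bool) (xs : List A) →
  anyᵇ g xs ≡ true → ∃ λ x → g x ≡ true
anyᵇ-witness g [] ()
anyᵇ-witness g (x ∷ xs) h with g x in gx
... | true = x , gx
... | false = anyᵇ-witness g xs h

anyᵇ-none : ∀ {A : Set} (g : A → Bool) {x : A} (xs : List A) →
  anyᵇ g xs ≡ false → x ∈ₗ xs → g x ≡ false
anyᵇ-none g (y ∷ ys) h (here refl) = proj₁ (∨-false⁻ (g y) h)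
anyᵇ-none g (y ∷ ys) h (there x∈ys) = anyᵇ-none g ys (proj₂ (∨-false⁻ (g y) h)) x∈ys

allSubsets-complete : ∀ {n} (X : Subset n) → X ∈ₗ allSubsets n
allSubsets-complete [] = here refl
allSubsets-complete (false ∷ X) = ∈-++⁺ˡ (∈-map⁺ (false ∷_) (allSubsets-complete X))
allSubsets-complete {suc n} (true ∷ X) =
  ∈-++⁺ʳ (map (false ∷_) (allSubsets n)) (∈-map⁺ (true ∷_) (allSubsets-complete X))

proper-or-empty : ∀ {n} (S : SetSystem n) → Proper S ⊎ (∀ X → S X ≡ false)
proper-or-empty {n} S with anyᵇ S (allSubsets n) in h
... | true = inj₁ (anyᵇ-witness S (allSubsets n) h)
... | false = inj₂ λ X → anyᵇ-none S (allSubsets n) h (allSubsets-complete X)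

slice : ∀ {n} → SetSystem (suc n) → Fin (suc n) → Bool → SetSystem n
slice T e b F = T (insertAt F e b)

contraction-slice : ∀ {n} (T : SetSystem (suc n)) (e : Fin (suc n)) →
  ∀ F → (T /ₑ e) F ≡ slice T e (containsNonLoop T e) F
contraction-slice T e F with containsNonLoop T e
... | true = refl
... | false = refl

loopSummand : ∀ {n} → SetSystem n → Subset n → Subset n → Subset n → Bool
loopSummand S A F F' = ((F ─ A) ⊆ᵇ F') ∧ (F' ⊆ᵇ F) ∧ S F'

-- Loop complementation evaluated at a set F with first element outside F:
-- only sets F' ⊆ F with first element outside contribute.
loop-head-out : ∀ {n} (S : SetSystem (suc n)) a A F →
  (S +ₗ (a ∷ A)) (false ∷ F) ≡ (slice S zero false +ₗ A) F
loop-head-out {n} S a A F =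
  trans (oddCount-allSubsets (loopSummand S (a ∷ A) (false ∷ F)))
    (trans (cong₂ _xor_ (oddCount-cong (lowerAgrees a) (allSubsets n))
                        (oddCount-none (upperVanishes a) (allSubsets n)))
           (xor-identityʳ ((slice S zero false +ₗ A) F)))
  where
  lowerAgrees : ∀ a' G →
    loopSummand S (a' ∷ A) (false ∷ F) (false ∷ G) ≡ loopSummand (slice S zero false) A F G
  lowerAgrees true G = refl
  lowerAgrees false G = refl
  upperVanishes : ∀ a' G → loopSummand S (a' ∷ A) (false ∷ F) (true ∷ G) ≡ false
  upperVanishes true G = ∧-zeroʳ ((F ─ A) ⊆ᵇ G)
  upperVanishes false G = ∧-zeroʳ ((F ─ A) ⊆ᵇ G)

-- First element in F but not in A: it must lie in every contributing F'.
loop-head-in : ∀ {n} (S : SetSystem (suc n)) A F →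
  (S +ₗ (false ∷ A)) (true ∷ F) ≡ (slice S zero true +ₗ A) F
loop-head-in {n} S A F =
  trans (oddCount-allSubsets (loopSummand S (false ∷ A) (true ∷ F)))
        (cong (_xor (slice S zero true +ₗ A) F) (oddCount-none (λ G → refl) (allSubsets n)))

-- First element in both F and A: both kinds of F' contribute.
loop-head-looped : ∀ {n} (S : SetSystem (suc n)) A F →
  (S +ₗ (true ∷ A)) (true ∷ F) ≡
  (slice S zero false +ₗ A) F xor (slice S zero true +ₗ A) F
loop-head-looped S A F = oddCount-allSubsets (loopSummand S (true ∷ A) (true ∷ F))

loop-empty : ∀ {n} (T : SetSystem n) → (∀ X → T X ≡ false) →
  ∀ A F → (T +ₗ A) F ≡ false
loop-empty {n} T empty A F = oddCount-none summandVanishes (allSubsets n)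
  where
  summandVanishes : ∀ G → loopSummand T A F G ≡ false
  summandVanishes G rewrite empty G =
    trans (cong (((F ─ A) ⊆ᵇ G) ∧_) (∧-zeroʳ (G ⊆ᵇ F))) (∧-zeroʳ ((F ─ A) ⊆ᵇ G))

loop-cong : ∀ {n} {T U : SetSystem n} → (∀ F → T F ≡ U F) →
  ∀ A F → (T +ₗ A) F ≡ (U +ₗ A) F
loop-cong {n} T≗U A F =
  oddCount-cong (λ G → cong (λ z → ((F ─ A) ⊆ᵇ G) ∧ (G ⊆ᵇ F) ∧ z) (T≗U G)) (allSubsets n)

insertAt-zipWith : ∀ {A B C : Set} {n} (f : A → B → C) (X : Vec A n) (Y : Vec B n)
  (e : Fin (suc n)) x y →
  zipWith f (insertAt X e x) (insertAt Y e y) ≡ insertAt (zipWith f X Y) e (f x y)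
insertAt-zipWith f X Y zero x y = refl
insertAt-zipWith f (a ∷ X) (b ∷ Y) (suc e) x y = cong (f a b ∷_) (insertAt-zipWith f X Y e x y)

insertAt-△-avoid : ∀ {n} (X A : Subset n) (e : Fin (suc n)) b →
  insertAt X e b △ insertAt A e false ≡ insertAt (X △ A) e b
insertAt-△-avoid X A e b =
  trans (insertAt-zipWith _xor_ X A e b false) (cong (insertAt (X △ A) e) (xor-identityʳ b))

insertAt-△-same : ∀ {n} (X Y : Subset n) (e : Fin (suc n)) b →
  insertAt X e b △ insertAt Y e b ≡ insertAt (X △ Y) e false
insertAt-△-same X Y e b =
  trans (insertAt-zipWith _xor_ X Y e b b) (cong (insertAt (X △ Y) e) (xor-same b))

insertAt-⊥ : ∀ {n} (e : Fin (suc n)) → insertAt ⊥ e false ≡ ⊥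
insertAt-⊥ zero = refl
insertAt-⊥ {suc n} (suc e) = cong (false ∷_) (insertAt-⊥ e)

⁅punchIn⁆ : ∀ {n} (e : Fin (suc n)) (u : Fin n) → ⁅ punchIn e u ⁆ ≡ insertAt ⁅ u ⁆ e false
⁅punchIn⁆ zero u = refl
⁅punchIn⁆ (suc e) zero = cong (true ∷_) (sym (insertAt-⊥ e))
⁅punchIn⁆ (suc e) (suc u) = cong (false ∷_) (⁅punchIn⁆ e u)

insertAt-exchange : ∀ {n} (X : Subset n) (e : Fin (suc n)) b (u v : Fin n) →
  insertAt X e b △ (⁅ punchIn e u ⁆ ∪ ⁅ punchIn e v ⁆) ≡ insertAt (X △ (⁅ u ⁆ ∪ ⁅ v ⁆)) e b
insertAt-exchange X e b u v = begin
    insertAt X e b △ (⁅ punchIn e u ⁆ ∪ ⁅ punchIn e v ⁆)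
  ≡⟨ cong₂ (λ p q → insertAt X e b △ (p ∪ q)) (⁅punchIn⁆ e u) (⁅punchIn⁆ e v) ⟩
    insertAt X e b △ (insertAt ⁅ u ⁆ e false ∪ insertAt ⁅ v ⁆ e false)
  ≡⟨ cong (insertAt X e b △_) (insertAt-zipWith _∨_ ⁅ u ⁆ ⁅ v ⁆ e false false) ⟩
    insertAt X e b △ insertAt (⁅ u ⁆ ∪ ⁅ v ⁆) e false
  ≡⟨ insertAt-△-avoid X (⁅ u ⁆ ∪ ⁅ v ⁆) e b ⟩
    insertAt (X △ (⁅ u ⁆ ∪ ⁅ v ⁆)) e b
  ∎
  where open ≡-Reasoning

∈-insertAt⁺ : ∀ {n} {Z : Subset n} {u : Fin n} (e : Fin (suc n)) b →
  u ∈ Z → punchIn e u ∈ insertAt Z e b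
∈-insertAt⁺ {Z = Z} {u} e b u∈Z =
  lookup⇒[]= (punchIn e u) _ (trans (insertAt-punchIn Z e b u) ([]=⇒lookup u∈Z))

∈-insertAt⁻ : ∀ {n} {Z : Subset n} {w : Fin (suc n)} (e : Fin (suc n)) →
  w ∈ insertAt Z e false → ∃ λ v → v ∈ Z × punchIn e v ≡ w
∈-insertAt⁻ {Z = Z} {w} e w∈ = punchOut e≢w , v∈Z , punchIn-punchOut e≢w
  where
  e≢w : e ≢ w
  e≢w refl with trans (sym ([]=⇒lookup w∈)) (insertAt-lookup Z e false)
  ... | ()
  v∈Z : punchOut e≢w ∈ Z
  v∈Z = lookup⇒[]= _ Z (begin
      lookup Z (punchOut e≢w)
    ≡⟨ sym (insertAt-punchIn Z e false (punchOut e≢w)) ⟩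
      lookup (insertAt Z e false) (punchIn e (punchOut e≢w))
    ≡⟨ cong (lookup (insertAt Z e false)) (punchIn-punchOut e≢w) ⟩
      lookup (insertAt Z e false) w
    ≡⟨ []=⇒lookup w∈ ⟩
      true
    ∎)
    where open ≡-Reasoning

slice-twist : ∀ {n} (T : SetSystem (suc n)) e b (A F : Subset n) →
  slice (T *ₜ insertAt A e false) e b F ≡ (slice T e b *ₜ A) F
slice-twist T e b A F = cong T (insertAt-△-avoid F A e b)

slice-loop : ∀ {n} (T : SetSystem (suc n)) e b (A F : Subset n) →
  slice (T +ₗ insertAt A e false) e b F ≡ (slice T e b +ₗ A) F
slice-loop T zero false A F = loop-head-out T false A F
slice-loop T zero true A F = loop-head-in T A F
slice-loop T (suc e) b (a ∷ A) (false ∷ F) = begin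
    (T +ₗ (a ∷ insertAt A e false)) (false ∷ insertAt F e b)
  ≡⟨ loop-head-out T a (insertAt A e false) (insertAt F e b) ⟩
    (slice T zero false +ₗ insertAt A e false) (insertAt F e b)
  ≡⟨ slice-loop (slice T zero false) e b A F ⟩
    (slice (slice T zero false) e b +ₗ A) F
  ≡⟨ sym (loop-head-out (slice T (suc e) b) a A F) ⟩
    (slice T (suc e) b +ₗ (a ∷ A)) (false ∷ F)
  ∎
  where open ≡-Reasoning
slice-loop T (suc e) b (false ∷ A) (true ∷ F) = begin
    (T +ₗ (false ∷ insertAt A e false)) (true ∷ insertAt F e b)
  ≡⟨ loop-head-in T (insertAt A e false) (insertAt F e b) ⟩
    (slice T zero true +ₗ insertAt A e false) (insertAt F e b)
  ≡⟨ slice-loop (slice T zero true) e b A F ⟩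
    (slice (slice T zero true) e b +ₗ A) F
  ≡⟨ sym (loop-head-in (slice T (suc e) b) A F) ⟩
    (slice T (suc e) b +ₗ (false ∷ A)) (true ∷ F)
  ∎
  where open ≡-Reasoning
slice-loop T (suc e) b (true ∷ A) (true ∷ F) = begin
    (T +ₗ (true ∷ insertAt A e false)) (true ∷ insertAt F e b)
  ≡⟨ loop-head-looped T (insertAt A e false) (insertAt F e b) ⟩
    (slice T zero false +ₗ insertAt A e false) (insertAt F e b)
      xor (slice T zero true +ₗ insertAt A e false) (insertAt F e b)
  ≡⟨ cong₂ _xor_ (slice-loop (slice T zero false) e b A F)
                 (slice-loop (slice T zero true) e b A F) ⟩
    (slice (slice T zero false) e b +ₗ A) F xor (slice (slice T zero true) e b +ₗ A) F
  ≡⟨ sym (loop-head-looped (slice T (suc e) b) A F) ⟩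
    (slice T (suc e) b +ₗ (true ∷ A)) (true ∷ F)
  ∎
  where open ≡-Reasoning

twistedDual-trans : ∀ {n} {S T U : SetSystem n} →
  TwistedDual S T → TwistedDual T U → TwistedDual S U
twistedDual-trans S→T tdRefl = S→T
twistedDual-trans S→T (tdTwist T→U A) = tdTwist (twistedDual-trans S→T T→U) A
twistedDual-trans S→T (tdLoop T→U A) = tdLoop (twistedDual-trans S→T T→U) A

twistedDual-slice : ∀ {n} {S : SetSystem (suc n)} {e b} {U T : SetSystem n} →
  (∀ F → U F ≡ slice S e b F) → TwistedDual U T →
  ∃ λ T' → TwistedDual S T' × (∀ F → T F ≡ slice T' e b F)
twistedDual-slice {S = S} U≗ tdRefl = S , tdRefl , U≗
twistedDual-slice {e = e} {b} U≗ (tdTwist td A) with twistedDual-slice U≗ td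
... | T' , td' , T≗ =
  T' *ₜ insertAt A e false , tdTwist td' (insertAt A e false) ,
  λ F → trans (T≗ (F △ A)) (sym (slice-twist T' e b A F))
twistedDual-slice {e = e} {b} U≗ (tdLoop td A) with twistedDual-slice U≗ td
... | T' , td' , T≗ =
  T' +ₗ insertAt A e false , tdLoop td' (insertAt A e false) ,
  λ F → trans (loop-cong T≗ A F) (sym (slice-loop T' e b A F))

-- The symmetric exchange axiom, the second half of IsDeltaMatroid.
Exchange : ∀ {n} → SetSystem n → Set
Exchange {n} S = ∀ (X Y : Subset n) → Feasible S X → Feasible S Y →
  ∀ (u : Fin n) → u ∈ (X △ Y) →
    ∃ λ (v : Fin n) → v ∈ (X △ Y) × Feasible S (X △ (⁅ u ⁆ ∪ ⁅ v ⁆))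

exchange-cong : ∀ {n} {T U : SetSystem n} → (∀ F → T F ≡ U F) → Exchange U → Exchange T
exchange-cong T≗U exch X Y hX hY u u∈
  with exch X Y (trans (sym (T≗U X)) hX) (trans (sym (T≗U Y)) hY) u u∈
... | v , v∈ , hV = v , v∈ , trans (T≗U _) hV

-- Exchange in a slice: lift X, Y, u into T, exchange there; the partner
-- is not e because X and Y agree at e, so it comes from E - e.
slice-exchange : ∀ {n} (T : SetSystem (suc n)) e b → Exchange T → Exchange (slice T e b)
slice-exchange T e b exch X Y hX hY u u∈
  with exch (insertAt X e b) (insertAt Y e b) hX hY (punchIn e u)
         (subst (punchIn e u ∈_) (sym (insertAt-△-same X Y e b)) (∈-insertAt⁺ e false u∈))
... | w , w∈ , hW with ∈-insertAt⁻ e (subst (w ∈_) (insertAt-△-same X Y e b) w∈)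
...   | v , v∈ , refl = v , v∈ , trans (cong T (sym (insertAt-exchange X e b u v))) hW

proper-cong : ∀ {n} {T U : SetSystem n} → (∀ F → T F ≡ U F) → Proper U → Proper T
proper-cong T≗U (X , hX) = X , trans (T≗U X) hX

twist-proper : ∀ {n} (T : SetSystem n) (A : Subset n) → Proper T → Proper (T *ₜ A)
twist-proper T A (X , hX) = X △ A , trans (cong T (△-involutive X A)) hX
  where
  △-involutive : ∀ {m} (X A : Subset m) → (X △ A) △ A ≡ X
  △-involutive [] [] = refl
  △-involutive (x ∷ X) (a ∷ A) =
    cong₂ _∷_ (trans (xor-assoc x a a) (trans (cong (x xor_) (xor-same a)) (xor-identityʳ x)))
              (△-involutive X A)

loop-head-upper : ∀ {n} (T : SetSystem (suc n)) → (∀ X → slice T zero false X ≡ false) →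
  ∀ a A F → (T +ₗ (a ∷ A)) (true ∷ F) ≡ (slice T zero true +ₗ A) F
loop-head-upper T empty⁰ false A F = loop-head-in T A F
loop-head-upper T empty⁰ true A F =
  trans (loop-head-looped T A F)
        (cong (_xor (slice T zero true +ₗ A) F) (loop-empty (slice T zero false) empty⁰ A F))

proper-upper : ∀ {n} (T : SetSystem (suc n)) → (∀ X → slice T zero false X ≡ false) →
  Proper T → Proper (slice T zero true)
proper-upper T empty⁰ (true ∷ X , hX) = X , hX
proper-upper T empty⁰ (false ∷ X , hX) with trans (sym hX) (empty⁰ X)
... | ()

-- Loop complementation preserves properness, by induction on the ground
-- set: if some feasible set avoids the first element, recurse there;
-- otherwise recurse on the feasible sets containing it.
loop-proper : ∀ {n} (T : SetSystem n) (A : Subset n) → Proper T → Proper (T +ₗ A)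
loop-proper T [] ([] , h) = [] , cong (_xor false) h
loop-proper T (a ∷ A) proper with proper-or-empty (slice T zero false)
... | inj₁ proper⁰ with loop-proper (slice T zero false) A proper⁰
...   | Y , hY = false ∷ Y , trans (loop-head-out T a A Y) hY
loop-proper T (a ∷ A) proper | inj₂ empty⁰
  with loop-proper (slice T zero true) A (proper-upper T empty⁰ proper)
... | Y , hY = true ∷ Y , trans (loop-head-upper T empty⁰ a A Y) hY

twistedDual-proper : ∀ {n} {S T : SetSystem n} → Proper S → TwistedDual S T → Proper T
twistedDual-proper pS tdRefl = pS
twistedDual-proper pS (tdTwist td A) = twist-proper _ A (twistedDual-proper pS td)
twistedDual-proper pS (tdLoop td A) = loop-proper _ A (twistedDual-proper pS td)

slice-at-feasible : ∀ {n} (T : SetSystem (suc n)) e X → T X ≡ true →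
  Proper (slice T e (lookup X e))
slice-at-feasible T e X hX = removeAt X e , trans (cong T (insertAt-removeAt X e)) hX

-- The slice selected by contraction is proper: if e is a non-loop use a
-- feasible set containing e, otherwise any feasible set (it avoids e).
slice-proper : ∀ {n} (T : SetSystem (suc n)) e → Proper T →
  Proper (slice T e (containsNonLoop T e))
slice-proper {n} T e (X , hX) with containsNonLoop T e in nonLoop
... | true with anyᵇ-witness (λ F → T F ∧ lookup F e) (allSubsets (suc n)) nonLoop
...   | F , hF with ∧-true⁻ (T F) hF
...     | hF' , e∈F = subst (λ b → Proper (slice T e b)) e∈F (slice-at-feasible T e F hF')
slice-proper {n} T e (X , hX) | false =
  subst (λ b → Proper (slice T e b)) e∉X (slice-at-feasible T e X hX)
  where
  e∉X : lookup X e ≡ false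
  e∉X = subst (λ t → t ∧ lookup X e ≡ false) hX
          (anyᵇ-none (λ F → T F ∧ lookup F e) (allSubsets (suc n)) nonLoop (allSubsets-complete X))

lemma4p1 : ∀ {n : ℕ} (S : SetSystem (suc n)) (e : Fin (suc n)) →
    IsVfSafe S → IsVfSafe (S ‡ e)
lemma4p1 {n} S e (_ , dualsAreDM) = deltaMatroid (S ‡ e) tdRefl , deltaMatroid
  where
  S+e : SetSystem (suc n)
  S+e = S +ₗ ⁅ e ⁆
  S→S+e : TwistedDual S S+e
  S→S+e = tdLoop tdRefl ⁅ e ⁆
  b : Bool
  b = containsNonLoop S+e e
  ‡-as-slice : ∀ F → (S ‡ e) F ≡ slice S+e e b F
  ‡-as-slice = contraction-slice S+e e
  ‡-proper : Proper (S ‡ e)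
  ‡-proper = proper-cong ‡-as-slice (slice-proper S+e e (proj₁ (dualsAreDM S+e S→S+e)))
  deltaMatroid : ∀ T → TwistedDual (S ‡ e) T → IsDeltaMatroid T
  deltaMatroid T td with twistedDual-slice ‡-as-slice td
  ... | T' , S+e→T' , T≗ =
    twistedDual-proper ‡-proper td ,
    exchange-cong T≗ (slice-exchange T' e b (proj₂ (dualsAreDM T' (twistedDual-trans S→S+e S+e→T'))))
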